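{- Let $a,h,d,k$ be positive integers with $\gcd(a,d)=1$, $a>2$, $d>h$, $1\leq 2k+1\leq a-1$, and let $A=(a,\ ha+d,\ ha+3d,\ ha+5d,\ \dots,\ ha+(2k+1)d)$. Write $a-1=(2k+1)s+t$ with $1\leq t\leq 2k+1$, and let $f(x)=\sum_{r=0}^{a-1}x^{N_r}$. Then $$f(x)=1+\frac{x^{ha+d}(1-x^{(ha+(2k+1)d)s})(1-x^{2d(k+1)})}{(1-x^{ha+(2k+1)d})(1-x^{2d})}+\frac{x^{2ha+2d}(1-x^{(ha+(2k+1)d)s})(1-x^{2dk})}{(1-x^{ha+(2k+1)d})(1-x^{2d})}+f_1(x),$$ where $$f_1(x)=\begin{cases}\dfrac{x^{ha(s+1)+d((2k+1)s+1)}(1-x^{d(t+1)})}{1-x^{2d}}+\dfrac{x^{ha(s+2)+d((2k+1)s+2)}(1-x^{d(t-1)})}{1-x^{2d}} & \text{if } t \text{ is odd},\\[8pt] \dfrac{x^{ha(s+1)+d((2k+1)s+1)}(1-x^{dt})}{1-x^{2d}}+\dfrac{x^{ha(s+2)+d((2k+1)s+2)}(1-x^{dt})}{1-x^{2d}} & \text{if } t \text{ is even}.\end{cases}$$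
   Context: For $A=(a,b_1,\dots,b_k)$ with $\gcd(A)=1$ and $0\le r\le a-1$, $N_r=\min\{a_0\in\mathbb{N} : a_0\equiv r \pmod a,\ a_0=\sum_{i}b_ix_i \text{ for some } x_i\in\mathbb{N}\}$ (here $(b_1,\dots,b_k)$ are the entries of $A$ other than the first). -}

module Defs where

open import Data.Nat as ℕ using (ℕ; zero; suc; _≤_; _%_; _∸_)
open import Data.Fin using (Fin; zero; suc; toℕ)
open import Data.Integer as ℤ using (ℤ)
open import Data.Product using (Σ; _×_)
open import Relation.Binary.PropositionalEquality using (_≡_)

sumFin : (n : ℕ) → (Fin n → ℕ) → ℕ
sumFin zero    f = 0
sumFin (suc n) f = f zero ℕ.+ sumFin n (λ i → f (suc i))

sumFinℤ : (n : ℕ) → (Fin n → ℤ) → ℤ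
sumFinℤ zero    f = ℤ.+ 0
sumFinℤ (suc n) f = f zero ℤ.+ sumFinℤ n (λ i → f (suc i))

gen : (a h d : ℕ) → {k : ℕ} → Fin (suc k) → ℕ
gen a h d i = h ℕ.* a ℕ.+ (2 ℕ.* toℕ i ℕ.+ 1) ℕ.* d

Representable : (a h d k : ℕ) → ℕ → Set
Representable a h d k n =
  Σ (Fin (suc k) → ℕ) λ xs → n ≡ sumFin (suc k) (λ i → gen a h d i ℕ.* xs i)

IsN : (a h d k : ℕ) → .{{_ : ℕ.NonZero a}} → ℕ → ℕ → Set
IsN a h d k r n =
  (n % a ≡ r % a) × Representable a h d k n ×
  (∀ m → m % a ≡ r % a → Representable a h d k m → n ≤ m)

-- Since d is a unit modulo a, the residues are r = j d mod a for j = 0, …, a − 1. A sum of M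
-- generators b_i = h a + (2i + 1) d is M h a + J d with M ≤ J ≤ (2k + 1) M and J ≡ M (mod 2),
-- and h ≤ d makes it cheapest to take J = j exactly with the fewest generators: writing
-- j = 1 + (2k + 1) q + u with u < 2k + 1, that is q + 1 of them for even u and q + 2 for odd u.
-- Thus N_r = m h a + j d for that number m, and summing x^{N_r} over the s full blocks of
-- 2k + 1 consecutive j and the final block of length t gives geometric series in x^{b_k} and x^{2d}.

module Submission where

open import Defs
open import Data.Nat as ℕ using (ℕ; suc; _≤_; _<_; _%_; _∸_; NonZero)
open import Data.Nat.GCD using (gcd)
open import Data.Fin using (Fin; toℕ)
open import Data.Integer as ℤ using (ℤ; +_; _-_; _^_)
open import Relation.Binary.PropositionalEquality using (_≡_)
open import Data.Product using (_×_)

open import Data.Nat using (zero; z≤n; s≤s; ⌊_/2⌋; ⌈_/2⌉)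
import Data.Nat.Properties as ℕP
open import Data.Nat.DivMod
open import Data.Nat.GCD using (module Bézout)
open import Data.Nat.Coprimality using (gcd≡1⇒coprime; coprime-Bézout)
import Data.Nat.Tactic.RingSolver as ℕ-Solver
open import Data.Fin using (zero; suc; fromℕ<)
open import Data.Fin.Properties using (toℕ-fromℕ<; toℕ-injective; toℕ<n)
open import Data.Fin.Permutation using (Permutation; permutation)
import Data.Integer.Properties as ℤP
import Data.Integer.Tactic.RingSolver as ℤ-Solver
open import Data.Product using (Σ-syntax; ∃-syntax; _,_; proj₁; proj₂)
open import Data.Sum using (_⊎_; inj₁; inj₂)
open import Function using (_∘_)
open import Relation.Binary.PropositionalEquality
  using (refl; sym; trans; cong; cong₂; subst; module ≡-Reasoning)
import Algebra.Properties.Semiring.Sum as SemiringSum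

module Halving where
  open import Data.Nat using (_+_; _*_)

  m<⌊n/2⌋⇒1+2m<n : ∀ n {m} → m < ⌊ n /2⌋ → suc (2 * m) < n
  m<⌊n/2⌋⇒1+2m<n (suc (suc n)) {zero}  _         = s≤s (s≤s z≤n)
  m<⌊n/2⌋⇒1+2m<n (suc (suc n)) {suc m} (s≤s m<) =
    subst (λ i → suc i < suc (suc n)) (sym (ℕP.*-suc 2 m)) (s≤s (s≤s (m<⌊n/2⌋⇒1+2m<n n m<)))

  m<⌈n/2⌉⇒2m<n : ∀ n {m} → m < ⌈ n /2⌉ → 2 * m < n
  m<⌈n/2⌉⇒2m<n n m< = ℕP.≤-pred (m<⌊n/2⌋⇒1+2m<n (suc n) m<)

  2n+1≡1+n+n : ∀ n → 2 * n + 1 ≡ suc (n + n)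
  2n+1≡1+n+n = ℕ-Solver.solve-∀

  ⌊1+2n/2⌋≡n : ∀ n → ⌊ 2 * n + 1 /2⌋ ≡ n
  ⌊1+2n/2⌋≡n n = trans (cong ⌊_/2⌋ (2n+1≡1+n+n n)) (sym (ℕP.n≡⌈n+n/2⌉ n))

  ⌈1+2n/2⌉≡1+n : ∀ n → ⌈ 2 * n + 1 /2⌉ ≡ suc n
  ⌈1+2n/2⌉≡1+n n = trans (cong ⌈_/2⌉ (2n+1≡1+n+n n)) (cong suc (sym (ℕP.n≡⌊n+n/2⌋ n)))

  2*⌈n/2⌉≡n+n%2 : ∀ n → 2 * ⌈ n /2⌉ ≡ n + n % 2
  2*⌈n/2⌉≡n+n%2 zero          = refl
  2*⌈n/2⌉≡n+n%2 (suc zero)    = refl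
  2*⌈n/2⌉≡n+n%2 (suc (suc n)) = trans (ℕP.*-suc 2 ⌈ n /2⌉) (cong (λ m → 2 + m) (2*⌈n/2⌉≡n+n%2 n))

  2*⌊n/2⌋+n%2≡n : ∀ n → 2 * ⌊ n /2⌋ + n % 2 ≡ n
  2*⌊n/2⌋+n%2≡n zero          = refl
  2*⌊n/2⌋+n%2≡n (suc zero)    = refl
  2*⌊n/2⌋+n%2≡n (suc (suc n)) =
    trans (cong (_+ n % 2) (ℕP.*-suc 2 ⌊ n /2⌋)) (cong (λ m → 2 + m) (2*⌊n/2⌋+n%2≡n n))

  2*⌊n/2⌋≡n∸n%2 : ∀ n → 2 * ⌊ n /2⌋ ≡ n ∸ n % 2
  2*⌊n/2⌋≡n∸n%2 n =
    trans (sym (ℕP.m+n∸n≡m (2 * ⌊ n /2⌋) (n % 2))) (cong (_∸ n % 2) (2*⌊n/2⌋+n%2≡n n))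

module NaturalSums where
  open import Data.Nat using (_+_; _*_)
  module ℕΣ = SemiringSum ℕP.+-*-semiring
  open ℕΣ public using (sum)

  sumFin≡sum : ∀ n (f : Fin n → ℕ) → sumFin n f ≡ sum f
  sumFin≡sum zero    f = refl
  sumFin≡sum (suc n) f = cong (λ w → f zero + w) (sumFin≡sum n (λ i → f (suc i)))

  sum-mono-≤ : ∀ {n} {f g : Fin n → ℕ} → (∀ i → f i ≤ g i) → sum f ≤ sum g
  sum-mono-≤ {zero}  f≤g = z≤n
  sum-mono-≤ {suc n} f≤g = ℕP.+-mono-≤ (f≤g zero) (sum-mono-≤ (λ i → f≤g (suc i)))

  δ : ∀ {n} → Fin n → Fin n → ℕ
  δ zero    zero    = 1
  δ zero    (suc _) = 0
  δ (suc _) zero    = 0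
  δ (suc i) (suc j) = δ i j

  sum-δ : ∀ {n} (f : Fin n → ℕ) (i : Fin n) → sum (λ j → f j * δ i j) ≡ f i
  sum-δ {suc n} f zero = begin
    f zero * 1 + sum {n} (λ j → f (suc j) * 0)
      ≡⟨ cong₂ _+_ (ℕP.*-identityʳ (f zero)) (ℕΣ.sum-cong-≗ (λ j → ℕP.*-zeroʳ (f (suc j)))) ⟩
    f zero + sum {n} (λ _ → 0)
      ≡⟨ cong (λ w → f zero + w) (ℕΣ.sum-replicate-zero n) ⟩
    f zero + 0
      ≡⟨ ℕP.+-identityʳ (f zero) ⟩
    f zero ∎
    where open ≡-Reasoning
  sum-δ {suc n} f (suc i) =
    trans (cong (_+ sum (λ j → f (suc j) * δ i j)) (ℕP.*-zeroʳ (f zero))) (sum-δ (f ∘ suc) i)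

module IntegerSums where
  open import Data.Integer using (_+_; _*_)
  open ℤ-Solver using (solve-∀)
  module ℤΣ = SemiringSum ℤP.+-*-semiring

  sumFinℤ≡sum : ∀ n (f : Fin n → ℤ) → sumFinℤ n f ≡ ℤΣ.sum f
  sumFinℤ≡sum zero    f = refl
  sumFinℤ≡sum (suc n) f = cong (λ w → f zero + w) (sumFinℤ≡sum n (λ i → f (suc i)))

  ∑ : ℕ → (ℕ → ℤ) → ℤ
  ∑ n F = ℤΣ.sum {n} (λ i → F (toℕ i))

  ∑-congᵇ : ∀ n {F G : ℕ → ℤ} → (∀ i → i < n → F i ≡ G i) → ∑ n F ≡ ∑ n G
  ∑-congᵇ n F≡G = ℤΣ.sum-cong-≗ (λ i → F≡G (toℕ i) (toℕ<n i))

  ∑-cong : ∀ n {F G : ℕ → ℤ} → (∀ i → F i ≡ G i) → ∑ n F ≡ ∑ n G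
  ∑-cong n F≡G = ∑-congᵇ n (λ i _ → F≡G i)

  ∑-*ˡ : ∀ n c (F : ℕ → ℤ) → ∑ n (λ i → c * F i) ≡ c * ∑ n F
  ∑-*ˡ n c F = sym (ℤΣ.*-distribˡ-sum c (λ (i : Fin n) → F (toℕ i)))

  ∑-*ʳ : ∀ n c (F : ℕ → ℤ) → ∑ n (λ i → F i * c) ≡ ∑ n F * c
  ∑-*ʳ n c F = sym (ℤΣ.*-distribʳ-sum c (λ (i : Fin n) → F (toℕ i)))

  ∑-+ : ∀ m n (F : ℕ → ℤ) → ∑ (m ℕ.+ n) F ≡ ∑ m F + ∑ n (λ i → F (m ℕ.+ i))
  ∑-+ zero    n F = sym (ℤP.+-identityˡ _)
  ∑-+ (suc m) n F =
    trans (cong (λ w → F 0 + w) (∑-+ m n (F ∘ suc))) (sym (ℤP.+-assoc (F 0) (∑ m (F ∘ suc)) _))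

  ∑-blocks : ∀ K s (F : ℕ → ℤ) → ∑ (K ℕ.* s) F ≡ ∑ s (λ q → ∑ K (λ u → F (K ℕ.* q ℕ.+ u)))
  ∑-blocks K zero    F = cong (λ n → ∑ n F) (ℕP.*-zeroʳ K)
  ∑-blocks K (suc s) F = begin
    ∑ (K ℕ.* suc s) F
      ≡⟨ cong (λ n → ∑ n F) (ℕP.*-suc K s) ⟩
    ∑ (K ℕ.+ K ℕ.* s) F
      ≡⟨ ∑-+ K (K ℕ.* s) F ⟩
    ∑ K F + ∑ (K ℕ.* s) (λ i → F (K ℕ.+ i))
      ≡⟨ cong₂ _+_ (∑-cong K first) (trans (∑-blocks K s (λ i → F (K ℕ.+ i))) (∑-cong s (λ q → ∑-cong K (shift q)))) ⟩
    ∑ (suc s) (λ q → ∑ K (λ u → F (K ℕ.* q ℕ.+ u))) ∎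
    where
    open ≡-Reasoning
    first : ∀ u → F u ≡ F (K ℕ.* 0 ℕ.+ u)
    first u = cong (λ m → F (m ℕ.+ u)) (sym (ℕP.*-zeroʳ K))
    shift : ∀ q u → F (K ℕ.+ (K ℕ.* q ℕ.+ u)) ≡ F (K ℕ.* suc q ℕ.+ u)
    shift q u = cong F (trans (sym (ℕP.+-assoc K (K ℕ.* q) u)) (cong (ℕ._+ u) (sym (ℕP.*-suc K q))))

  ∑-parity : ∀ n (F : ℕ → ℤ) →
    ∑ n F ≡ ∑ ⌈ n /2⌉ (λ v → F (2 ℕ.* v)) + ∑ ⌊ n /2⌋ (λ v → F (suc (2 ℕ.* v)))
  ∑-parity zero    F = refl
  ∑-parity (suc n) F = begin
    F 0 + ∑ n (F ∘ suc)
      ≡⟨ cong (λ w → F 0 + w) (∑-parity n (F ∘ suc)) ⟩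
    F 0 + (odd + even⁺)
      ≡⟨ swap (F 0) odd even⁺ ⟩
    (F 0 + even⁺) + odd
      ≡⟨ cong (λ w → (F 0 + w) + odd) (∑-cong ⌊ n /2⌋ (λ v → cong F (sym (ℕP.*-suc 2 v)))) ⟩
    ∑ (suc ⌊ n /2⌋) (λ v → F (2 ℕ.* v)) + odd ∎
    where
    open ≡-Reasoning
    odd   = ∑ ⌈ n /2⌉ (λ v → F (suc (2 ℕ.* v)))
    even⁺ = ∑ ⌊ n /2⌋ (λ v → F (suc (suc (2 ℕ.* v))))
    swap : ∀ (a b c : ℤ) → a + (b + c) ≡ (a + c) + b
    swap = solve-∀

  ∑-geometric : ∀ n (y : ℤ) → (+ 1 - y) * ∑ n (y ^_) ≡ + 1 - y ^ n
  ∑-geometric zero    y = ℤP.*-zeroʳ (+ 1 - y)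
  ∑-geometric (suc n) y = begin
    (+ 1 - y) * (+ 1 + ∑ n (λ i → y * y ^ i)) ≡⟨ cong (λ w → (+ 1 - y) * (+ 1 + w)) (∑-*ˡ n y (y ^_)) ⟩
    (+ 1 - y) * (+ 1 + y * S)                 ≡⟨ expand y S ⟩
    + 1 - y + y * ((+ 1 - y) * S)             ≡⟨ cong (λ w → + 1 - y + y * w) (∑-geometric n y) ⟩
    + 1 - y + y * (+ 1 - y ^ n)               ≡⟨ collapse y (y ^ n) ⟩
    + 1 - y * y ^ n                           ∎
    where
    open ≡-Reasoning
    S = ∑ n (y ^_)
    expand : ∀ (y S : ℤ) → (+ 1 - y) * (+ 1 + y * S) ≡ + 1 - y + y * ((+ 1 - y) * S)
    expand = solve-∀
    collapse : ∀ (y w : ℤ) → + 1 - y + y * (+ 1 - w) ≡ + 1 - y * w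
    collapse = solve-∀

  ∑-geometric-^ : ∀ (x : ℤ) m n → (+ 1 - x ^ m) * ∑ n ((x ^ m) ^_) ≡ + 1 - x ^ (m ℕ.* n)
  ∑-geometric-^ x m n = trans (∑-geometric n (x ^ m)) (cong (λ w → + 1 - w) (ℤP.^-*-assoc x m n))

module Modular {a : ℕ} .{{_ : NonZero a}} where
  open import Data.Nat using (_+_; _*_)
  open ℕ-Solver using (solve-∀)

  [m%a*n]%a≡[m*n]%a : ∀ m n → (m % a * n) % a ≡ (m * n) % a
  [m%a*n]%a≡[m*n]%a m n = begin
    (m % a * n) % a             ≡⟨ %-distribˡ-* (m % a) n a ⟩
    (m % a % a * (n % a)) % a   ≡⟨ cong (λ w → (w * (n % a)) % a) (m%n%n≡m%n m a) ⟩
    (m % a * (n % a)) % a       ≡⟨ %-distribˡ-* m n a ⟨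
    (m * n) % a                 ∎
    where open ≡-Reasoning

  [m*u]%a≡m%a : ∀ m {u} → u % a ≡ 1 → (m * u) % a ≡ m % a
  [m*u]%a≡m%a m {u} u≡1 = begin
    (m * u) % a               ≡⟨ %-distribˡ-* m u a ⟩
    (m % a * (u % a)) % a     ≡⟨ cong (λ w → (m % a * w) % a) u≡1 ⟩
    (m % a * 1) % a           ≡⟨ cong (_% a) (ℕP.*-identityʳ (m % a)) ⟩
    m % a % a                 ≡⟨ m%n%n≡m%n m a ⟩
    m % a                     ∎
    where open ≡-Reasoning

  [m*[n*a]+o]%a≡o%a : ∀ m n o → (m * (n * a) + o) % a ≡ o % a
  [m*[n*a]+o]%a≡o%a m n o = trans (cong (_% a) (reorder m n a o)) ([m+kn]%n≡m%n o (m * n) a)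
    where
    reorder : ∀ m n a o → m * (n * a) + o ≡ o + m * n * a
    reorder = solve-∀

  %≡⇒≡⊎+a≤ : ∀ {m n} → n < a → m % a ≡ n → m ≡ n ⊎ n + a ≤ m
  %≡⇒≡⊎+a≤ {m} {n} n<a m%a≡n with m / a | m≡m%n+[m/n]*n m a
  ... | zero  | m≡ = inj₁ (trans m≡ (trans (ℕP.+-identityʳ (m % a)) m%a≡n))
  ... | suc q | m≡ = inj₂ (begin
    n + a              ≤⟨ ℕP.+-monoʳ-≤ n (ℕP.m≤m+n a (q * a)) ⟩
    n + suc q * a      ≡⟨ cong (_+ suc q * a) m%a≡n ⟨
    m % a + suc q * a  ≡⟨ m≡ ⟨
    m                  ∎)
    where open ℕP.≤-Reasoning

  toℕ-mod : ∀ m → toℕ (m mod a) ≡ m % a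
  toℕ-mod m = toℕ-fromℕ< (m%n<n m a)

  mod-inverse : ∀ {u v} → (u * v) % a ≡ 1 → ∀ i → ((toℕ ((toℕ i * u) mod a) * v) mod a) ≡ i
  mod-inverse {u} {v} uv≡1 i = toℕ-injective (begin
    toℕ ((toℕ ((toℕ i * u) mod a) * v) mod a)  ≡⟨ toℕ-mod _ ⟩
    (toℕ ((toℕ i * u) mod a) * v) % a          ≡⟨ cong (λ w → (w * v) % a) (toℕ-mod (toℕ i * u)) ⟩
    (toℕ i * u % a * v) % a                    ≡⟨ [m%a*n]%a≡[m*n]%a (toℕ i * u) v ⟩
    (toℕ i * u * v) % a                        ≡⟨ cong (_% a) (ℕP.*-assoc (toℕ i) u v) ⟩
    (toℕ i * (u * v)) % a                      ≡⟨ [m*u]%a≡m%a (toℕ i) uv≡1 ⟩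
    toℕ i % a                                  ≡⟨ m<n⇒m%n≡m (toℕ<n i) ⟩
    toℕ i                                      ∎)
    where open ≡-Reasoning

  coprime⇒invertible : 1 < a → ∀ d → gcd a d ≡ 1 → ∃[ e ] (e * d) % a ≡ 1
  coprime⇒invertible 1<a d gcd≡1 with coprime-Bézout (gcd≡1⇒coprime gcd≡1)
  ... | Bézout.-+ x y 1+xa≡yd = y , (begin
    (y * d) % a         ≡⟨ cong (_% a) 1+xa≡yd ⟨
    (1 + x * a) % a     ≡⟨ [m+kn]%n≡m%n 1 x a ⟩
    1 % a               ≡⟨ m<n⇒m%n≡m 1<a ⟩
    1                   ∎)
    where open ≡-Reasoning
  ... | Bézout.+- x y 1+yd≡xa = invert a 1<a 1+yd≡xa
    where
    -- (a - 1) y is an inverse since y d ≡ -1 (mod a).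
    invert : ∀ b .{{_ : NonZero b}} → 1 < b → 1 + y * d ≡ x * b → ∃[ e ] (e * d) % b ≡ 1
    invert (suc c) 1<b 1+yd≡xb = c * y , (begin
      (c * y * d) % suc c             ≡⟨ [m+n]%n≡m%n (c * y * d) (suc c) ⟨
      (c * y * d + suc c) % suc c     ≡⟨ cong (_% suc c) (regroup c y d) ⟩
      (1 + c * (1 + y * d)) % suc c   ≡⟨ cong (λ w → (1 + c * w) % suc c) 1+yd≡xb ⟩
      (1 + c * (x * suc c)) % suc c   ≡⟨ cong (λ w → (1 + w) % suc c) (ℕP.*-assoc c x (suc c)) ⟨
      (1 + c * x * suc c) % suc c     ≡⟨ [m+kn]%n≡m%n 1 (c * x) (suc c) ⟩
      1 % suc c                       ≡⟨ m<n⇒m%n≡m 1<b ⟩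
      1                               ∎)
      where
      open ≡-Reasoning
      regroup : ∀ c y d → c * y * d + suc c ≡ 1 + c * (1 + y * d)
      regroup = solve-∀

  module Unit (d e : ℕ) (ed≡1 : (e * d) % a ≡ 1) where

    de≡1 : (d * e) % a ≡ 1
    de≡1 = trans (cong (_% a) (ℕP.*-comm d e)) ed≡1

    %-cancelʳ-* : ∀ m n → (m * d) % a ≡ (n * d) % a → m % a ≡ n % a
    %-cancelʳ-* m n md≡nd = begin
      m % a                 ≡⟨ [m*u]%a≡m%a m de≡1 ⟨
      (m * (d * e)) % a     ≡⟨ cong (_% a) (ℕP.*-assoc m d e) ⟨
      (m * d * e) % a       ≡⟨ [m%a*n]%a≡[m*n]%a (m * d) e ⟨
      (m * d % a * e) % a   ≡⟨ cong (λ w → (w * e) % a) md≡nd ⟩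
      (n * d % a * e) % a   ≡⟨ [m%a*n]%a≡[m*n]%a (n * d) e ⟩
      (n * d * e) % a       ≡⟨ cong (_% a) (ℕP.*-assoc n d e) ⟩
      (n * (d * e)) % a     ≡⟨ [m*u]%a≡m%a n de≡1 ⟩
      n % a                 ∎
      where open ≡-Reasoning

    ρ : ℕ → Fin a
    ρ j = (j * d) mod a

    ρ-% : ∀ j → toℕ (ρ j) % a ≡ (j * d) % a
    ρ-% j = trans (cong (_% a) (toℕ-mod (j * d))) (m%n%n≡m%n (j * d) a)

    ρ-permutation : Permutation a a
    ρ-permutation = permutation (ρ ∘ toℕ) (λ i → (toℕ i * e) mod a) (mod-inverse ed≡1) (mod-inverse de≡1)

module Representations (a h d k : ℕ) where
  open import Data.Nat using (_+_; _*_)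
  open ℕ-Solver using (solve-∀)
  open NaturalSums

  Rep : ℕ → Set
  Rep = Representable a h d k

  b : Fin (suc k) → ℕ
  b = gen a h d

  sumFin-gen≡sum : ∀ (xs : Fin (suc k) → ℕ) →
    sumFin (suc k) (λ i → b i * xs i) ≡ sum (λ i → b i * xs i)
  sumFin-gen≡sum xs = sumFin≡sum (suc k) (λ i → b i * xs i)

  rep-0 : Rep 0
  rep-0 = (λ _ → 0) , sym (trans (sumFin-gen≡sum (λ _ → 0))
            (trans (ℕΣ.sum-cong-≗ (λ i → ℕP.*-zeroʳ (b i))) (ℕΣ.sum-replicate-zero (suc k))))

  rep-gen : ∀ i → i ≤ k → Rep (h * a + (2 * i + 1) * d)
  rep-gen i i≤k = δ j , sym (begin
    sumFin (suc k) (λ l → b l * δ j l)  ≡⟨ sumFin-gen≡sum (δ j) ⟩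
    sum (λ l → b l * δ j l)             ≡⟨ sum-δ b j ⟩
    b j                                 ≡⟨ cong (λ l → h * a + (2 * l + 1) * d) (toℕ-fromℕ< (s≤s i≤k)) ⟩
    h * a + (2 * i + 1) * d             ∎)
    where
    open ≡-Reasoning
    j = fromℕ< (s≤s i≤k)

  rep-+ : ∀ {m n} → Rep m → Rep n → Rep (m + n)
  rep-+ {m} {n} (xs , m≡) (ys , n≡) = (λ i → xs i + ys i) , (begin
    m + n
      ≡⟨ cong₂ _+_ (trans m≡ (sumFin-gen≡sum xs)) (trans n≡ (sumFin-gen≡sum ys)) ⟩
    sum (λ i → b i * xs i) + sum (λ i → b i * ys i)
      ≡⟨ ℕΣ.∑-distrib-+ (λ i → b i * xs i) (λ i → b i * ys i) ⟨
    sum (λ i → b i * xs i + b i * ys i)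
      ≡⟨ ℕΣ.sum-cong-≗ (λ i → ℕP.*-distribˡ-+ (b i) (xs i) (ys i)) ⟨
    sum (λ i → b i * (xs i + ys i))
      ≡⟨ sumFin-gen≡sum (λ i → xs i + ys i) ⟨
    sumFin (suc k) (λ i → b i * (xs i + ys i)) ∎)
    where open ≡-Reasoning

  rep-* : ∀ c {n} → Rep n → Rep (c * n)
  rep-* zero    _     = rep-0
  rep-* (suc c) rep-n = rep-+ rep-n (rep-* c rep-n)

  rep-decompose : ∀ {m} → Rep m →
    Σ[ M ∈ ℕ ] Σ[ W ∈ ℕ ] (m ≡ M * (h * a) + (M + 2 * W) * d) × (W ≤ k * M)
  rep-decompose {m} (xs , m≡) = M , W , m≡MW , W≤kM
    where
    M = sum xs
    W = sum (λ i → toℕ i * xs i)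
    split : ∀ i → b i * xs i ≡ (h * a + d) * xs i + 2 * d * (toℕ i * xs i)
    split i = distribute h a (toℕ i) d (xs i)
      where
      distribute : ∀ h a t d x → (h * a + (2 * t + 1) * d) * x ≡ (h * a + d) * x + 2 * d * (t * x)
      distribute = solve-∀
    regroup : ∀ h a d M W → (h * a + d) * M + 2 * d * W ≡ M * (h * a) + (M + 2 * W) * d
    regroup = solve-∀
    m≡MW : m ≡ M * (h * a) + (M + 2 * W) * d
    m≡MW = begin
      m
        ≡⟨ trans m≡ (sumFin-gen≡sum xs) ⟩
      sum (λ i → b i * xs i)
        ≡⟨ ℕΣ.sum-cong-≗ split ⟩
      sum (λ i → (h * a + d) * xs i + 2 * d * (toℕ i * xs i))
        ≡⟨ ℕΣ.∑-distrib-+ (λ i → (h * a + d) * xs i) (λ i → 2 * d * (toℕ i * xs i)) ⟩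
      sum (λ i → (h * a + d) * xs i) + sum (λ i → 2 * d * (toℕ i * xs i))
        ≡⟨ cong₂ _+_ (ℕΣ.*-distribˡ-sum (h * a + d) xs) (ℕΣ.*-distribˡ-sum (2 * d) (λ i → toℕ i * xs i)) ⟨
      (h * a + d) * M + 2 * d * W
        ≡⟨ regroup h a d M W ⟩
      M * (h * a) + (M + 2 * W) * d ∎
      where open ≡-Reasoning
    W≤kM : W ≤ k * M
    W≤kM = ℕP.≤-trans (sum-mono-≤ (λ i → ℕP.*-monoˡ-≤ (xs i) (ℕP.≤-pred (toℕ<n i))))
                      (ℕP.≤-reflexive (sym (ℕΣ.*-distribˡ-sum k xs)))

module Values (a h d k : ℕ) .{{_ : NonZero a}} (h≤d : h ≤ d) (e : ℕ) (ed≡1 : (e ℕ.* d) % a ≡ 1) where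
  open import Data.Nat using (_+_; _*_)
  open ℕ-Solver using (solve-∀)
  open Modular {a}
  open Unit d e ed≡1
  open Representations a h d k

  spread-≤ : ∀ {M W} → W ≤ k * M → M + 2 * W ≤ (2 * k + 1) * M
  spread-≤ {M} {W} W≤kM = begin
    M + 2 * W            ≤⟨ ℕP.+-monoʳ-≤ M (ℕP.*-monoʳ-≤ 2 W≤kM) ⟩
    M + 2 * (k * M)      ≡⟨ collect k M ⟩
    (2 * k + 1) * M      ∎
    where
    open ℕP.≤-Reasoning
    collect : ∀ k M → M + 2 * (k * M) ≡ (2 * k + 1) * M
    collect = solve-∀

  wrap-≤ : ∀ {m₀ M j J} → m₀ ≤ suc M → j + a ≤ J → m₀ * (h * a) + j * d ≤ M * (h * a) + J * d
  wrap-≤ {m₀} {M} {j} {J} m₀≤1+M j+a≤J = begin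
    m₀ * (h * a) + j * d            ≤⟨ ℕP.+-monoˡ-≤ (j * d) (ℕP.*-monoˡ-≤ (h * a) m₀≤1+M) ⟩
    suc M * (h * a) + j * d         ≡⟨ peel M h a j d ⟩
    M * (h * a) + h * a + j * d     ≤⟨ ℕP.+-monoˡ-≤ (j * d) (ℕP.+-monoʳ-≤ (M * (h * a)) (ℕP.*-monoˡ-≤ a h≤d)) ⟩
    M * (h * a) + d * a + j * d     ≡⟨ merge M h a j d ⟩
    M * (h * a) + (j + a) * d       ≤⟨ ℕP.+-monoʳ-≤ (M * (h * a)) (ℕP.*-monoˡ-≤ d j+a≤J) ⟩
    M * (h * a) + J * d             ∎
    where
    open ℕP.≤-Reasoning
    peel : ∀ M h a j d → suc M * (h * a) + j * d ≡ M * (h * a) + h * a + j * d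
    peel = solve-∀
    merge : ∀ M h a j d → M * (h * a) + d * a + j * d ≡ M * (h * a) + (j + a) * d
    merge = solve-∀

  -- A combination of M generators is M h a + J d with J = M + 2 W ≤ (2k+1) M (rep-decompose).
  -- If it is ≡ j d (mod a) then either J = j, covered by exact, or J ≥ j + a, where wrapped
  -- gives m₀ ≤ M + 1 and the surplus a d ≥ h a pays for the extra generator.
  module _ {j m₀ : ℕ} (j<a : j < a)
           (exact   : ∀ M W → W ≤ k * M → M + 2 * W ≡ j → m₀ ≤ M)
           (wrapped : ∀ M → j < (2 * k + 1) * M → m₀ ≤ suc M) where

    ρ-lowerBound : ∀ {m} → m % a ≡ (j * d) % a → Rep m → m₀ * (h * a) + j * d ≤ m
    ρ-lowerBound {m} m≡jd rep-m with rep-decompose rep-m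
    ... | M , W , m≡ , W≤kM with %≡⇒≡⊎+a≤ j<a J%a≡j
      where
      J%a≡j : (M + 2 * W) % a ≡ j
      J%a≡j = trans (%-cancelʳ-* (M + 2 * W) j (begin
        ((M + 2 * W) * d) % a                        ≡⟨ [m*[n*a]+o]%a≡o%a M h ((M + 2 * W) * d) ⟨
        (M * (h * a) + (M + 2 * W) * d) % a          ≡⟨ cong (_% a) m≡ ⟨
        m % a                                        ≡⟨ m≡jd ⟩
        (j * d) % a                                  ∎)) (m<n⇒m%n≡m j<a)
        where open ≡-Reasoning
    ... | inj₁ J≡j = begin
      m₀ * (h * a) + j * d             ≤⟨ ℕP.+-monoˡ-≤ (j * d) (ℕP.*-monoˡ-≤ (h * a) (exact M W W≤kM J≡j)) ⟩
      M * (h * a) + j * d              ≡⟨ cong (λ J → M * (h * a) + J * d) J≡j ⟨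
      M * (h * a) + (M + 2 * W) * d    ≡⟨ m≡ ⟨
      m                                ∎
      where open ℕP.≤-Reasoning
    ... | inj₂ j+a≤J = begin
      m₀ * (h * a) + j * d             ≤⟨ wrap-≤ (wrapped M j<KM) j+a≤J ⟩
      M * (h * a) + (M + 2 * W) * d    ≡⟨ m≡ ⟨
      m                                ∎
      where
      open ℕP.≤-Reasoning
      j<KM : j < (2 * k + 1) * M
      j<KM = ℕP.<-≤-trans (ℕP.m<m+n j (ℕ.>-nonZero⁻¹ a)) (ℕP.≤-trans j+a≤J (spread-≤ W≤kM))

    IsN-ρ : ∀ {n} → Rep (m₀ * (h * a) + j * d) → IsN a h d k (toℕ (ρ j)) n → n ≡ m₀ * (h * a) + j * d
    IsN-ρ {n} rep-m₀ (n≡ , rep-n , least) = ℕP.≤-antisym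
      (least _ (trans ([m*[n*a]+o]%a≡o%a m₀ h (j * d)) (sym (ρ-% j))) rep-m₀)
      (ρ-lowerBound (trans n≡ (ρ-% j)) rep-n)

  IsN-ρ0 : ∀ {n} → IsN a h d k (toℕ (ρ 0)) n → n ≡ 0
  IsN-ρ0 (_ , _ , least) = ℕP.n≤0⇒n≡0 (least 0 (sym (ρ-% 0)) rep-0)

  q<M : ∀ {q u M} → suc ((2 * k + 1) * q + u) ≤ (2 * k + 1) * M → q < M
  q<M {q} {u} {M} le = ℕP.*-cancelˡ-< (2 * k + 1) q M (ℕP.≤-trans (s≤s (ℕP.m≤m+n _ u)) le)

  exact⇒q<M : ∀ {q u M W} → W ≤ k * M → M + 2 * W ≡ suc ((2 * k + 1) * q + u) → q < M
  exact⇒q<M {q} {u} {M} W≤kM M+2W≡j = q<M {q} {u} (subst (_≤ (2 * k + 1) * M) M+2W≡j (spread-≤ W≤kM))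

  IsN-even : ∀ q v {n} → v ≤ k → suc ((2 * k + 1) * q + 2 * v) < a →
    IsN a h d k (toℕ (ρ (suc ((2 * k + 1) * q + 2 * v)))) n →
    n ≡ suc q * (h * a) + suc ((2 * k + 1) * q + 2 * v) * d
  IsN-even q v v≤k j<a = IsN-ρ j<a exact wrapped rep
    where
    exact : ∀ M W → W ≤ k * M → M + 2 * W ≡ _ → suc q ≤ M
    exact M W W≤kM M+2W≡j = exact⇒q<M W≤kM M+2W≡j
    wrapped : ∀ M → _ < (2 * k + 1) * M → suc q ≤ suc M
    wrapped M j<KM = ℕP.m≤n⇒m≤1+n (q<M (ℕP.<⇒≤ j<KM))
    decompose : ∀ q k v h a d → suc q * (h * a) + suc ((2 * k + 1) * q + 2 * v) * d
      ≡ q * (h * a + (2 * k + 1) * d) + (h * a + (2 * v + 1) * d)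
    decompose = solve-∀
    rep : Rep (suc q * (h * a) + suc ((2 * k + 1) * q + 2 * v) * d)
    rep = subst Rep (sym (decompose q k v h a d)) (rep-+ (rep-* q (rep-gen k ℕP.≤-refl)) (rep-gen v v≤k))

  IsN-odd : ∀ q v {n} → v < k → suc ((2 * k + 1) * q + suc (2 * v)) < a →
    IsN a h d k (toℕ (ρ (suc ((2 * k + 1) * q + suc (2 * v))))) n →
    n ≡ suc (suc q) * (h * a) + suc ((2 * k + 1) * q + suc (2 * v)) * d
  IsN-odd q v v<k j<a = IsN-ρ j<a exact wrapped rep
    where
    parity : ∀ k q v W → q + 2 * W ≡ (2 * k + 1) * q + suc (2 * v) → 2 * W ≡ suc (2 * (k * q + v))
    parity k q v W eq = ℕP.+-cancelˡ-≡ q _ _ (trans eq (shift k q v))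
      where
      shift : ∀ k q v → (2 * k + 1) * q + suc (2 * v) ≡ q + suc (2 * (k * q + v))
      shift = solve-∀
    -- With M = q + 1 generators the index sum M + 2 W has the parity of q + 1, but j has that of q.
    exact : ∀ M W → W ≤ k * M → M + 2 * W ≡ _ → suc (suc q) ≤ M
    exact M W W≤kM M+2W≡j = ℕP.≤∧≢⇒< (exact⇒q<M {q} W≤kM M+2W≡j)
      λ { refl → ℕP.even≢odd W (k * q + v) (parity k q v W (ℕP.suc-injective M+2W≡j)) }
    wrapped : ∀ M → _ < (2 * k + 1) * M → suc (suc q) ≤ suc M
    wrapped M j<KM = s≤s (q<M (ℕP.<⇒≤ j<KM))
    decompose : ∀ q k v h a d → suc (suc q) * (h * a) + suc ((2 * k + 1) * q + suc (2 * v)) * d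
      ≡ q * (h * a + (2 * k + 1) * d) + ((h * a + (2 * 0 + 1) * d) + (h * a + (2 * v + 1) * d))
    decompose = solve-∀
    rep : Rep (suc (suc q) * (h * a) + suc ((2 * k + 1) * q + suc (2 * v)) * d)
    rep = subst Rep (sym (decompose q k v h a d))
            (rep-+ (rep-* q (rep-gen k ℕP.≤-refl)) (rep-+ (rep-gen 0 z≤n) (rep-gen v (ℕP.<⇒≤ v<k))))

module GeneratingFunction
  (a h d k s t : ℕ) .{{_ : NonZero a}} (h≤d : h ≤ d) (e : ℕ) (ed≡1 : (e ℕ.* d) % a ≡ 1)
  (a≡ : a ≡ suc ((2 ℕ.* k ℕ.+ 1) ℕ.* s ℕ.+ t)) (t≤K : t ≤ 2 ℕ.* k ℕ.+ 1)
  (N : Fin a → ℕ) (isN : ∀ r → IsN a h d k (toℕ r) (N r)) (x : ℤ) where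
  open import Data.Integer using (_+_; _*_)
  open Halving
  open IntegerSums
  open Modular {a}
  open Unit d e ed≡1
  open Values a h d k h≤d e ed≡1

  K P : ℕ
  K = 2 ℕ.* k ℕ.+ 1
  P = h ℕ.* a ℕ.+ K ℕ.* d

  Z Y X₁ X₂ : ℤ
  Z  = x ^ P
  Y  = x ^ (2 ℕ.* d)
  X₁ = x ^ (h ℕ.* a ℕ.+ d)
  X₂ = x ^ (2 ℕ.* h ℕ.* a ℕ.+ 2 ℕ.* d)

  G : ℕ → ℤ
  G n = ∑ n (Y ^_)

  Ψ : ℕ → ℤ
  Ψ j = x ^ N (ρ j)

  Block Rest : ℤ
  Block = X₁ * G (suc k) + X₂ * G k
  Rest  = X₁ * G ⌈ t /2⌉ + X₂ * G ⌊ t /2⌋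

  ^-split : ∀ A B C q v → x ^ (A ℕ.* q ℕ.+ (B ℕ.+ C ℕ.* v)) ≡ (x ^ A) ^ q * (x ^ B * (x ^ C) ^ v)
  ^-split A B C q v = begin
    x ^ (A ℕ.* q ℕ.+ (B ℕ.+ C ℕ.* v))
      ≡⟨ ℤP.^-distribˡ-+-* x (A ℕ.* q) (B ℕ.+ C ℕ.* v) ⟩
    x ^ (A ℕ.* q) * x ^ (B ℕ.+ C ℕ.* v)
      ≡⟨ cong₂ _*_ (sym (ℤP.^-*-assoc x A q)) (ℤP.^-distribˡ-+-* x B (C ℕ.* v)) ⟩
    (x ^ A) ^ q * (x ^ B * x ^ (C ℕ.* v))
      ≡⟨ cong (λ w → (x ^ A) ^ q * (x ^ B * w)) (sym (ℤP.^-*-assoc x C v)) ⟩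
    (x ^ A) ^ q * (x ^ B * (x ^ C) ^ v) ∎
    where open ≡-Reasoning

  Ψ-even : ∀ q v → v ≤ k → suc (K ℕ.* q ℕ.+ 2 ℕ.* v) < a →
    Ψ (suc (K ℕ.* q ℕ.+ 2 ℕ.* v)) ≡ Z ^ q * (X₁ * Y ^ v)
  Ψ-even q v v≤k j<a = trans (cong (x ^_) (trans (IsN-even q v v≤k j<a (isN _)) (exponent h a k d q v)))
    (^-split P (h ℕ.* a ℕ.+ d) (2 ℕ.* d) q v)
    where
    exponent : ∀ h a k d q v →
      suc q ℕ.* (h ℕ.* a) ℕ.+ suc ((2 ℕ.* k ℕ.+ 1) ℕ.* q ℕ.+ 2 ℕ.* v) ℕ.* d
      ≡ (h ℕ.* a ℕ.+ (2 ℕ.* k ℕ.+ 1) ℕ.* d) ℕ.* q ℕ.+ ((h ℕ.* a ℕ.+ d) ℕ.+ 2 ℕ.* d ℕ.* v)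
    exponent = ℕ-Solver.solve-∀

  Ψ-odd : ∀ q v → v < k → suc (K ℕ.* q ℕ.+ suc (2 ℕ.* v)) < a →
    Ψ (suc (K ℕ.* q ℕ.+ suc (2 ℕ.* v))) ≡ Z ^ q * (X₂ * Y ^ v)
  Ψ-odd q v v<k j<a = trans (cong (x ^_) (trans (IsN-odd q v v<k j<a (isN _)) (exponent h a k d q v)))
    (^-split P (2 ℕ.* h ℕ.* a ℕ.+ 2 ℕ.* d) (2 ℕ.* d) q v)
    where
    exponent : ∀ h a k d q v →
      suc (suc q) ℕ.* (h ℕ.* a) ℕ.+ suc ((2 ℕ.* k ℕ.+ 1) ℕ.* q ℕ.+ suc (2 ℕ.* v)) ℕ.* d
      ≡ (h ℕ.* a ℕ.+ (2 ℕ.* k ℕ.+ 1) ℕ.* d) ℕ.* q ℕ.+ ((2 ℕ.* h ℕ.* a ℕ.+ 2 ℕ.* d) ℕ.+ 2 ℕ.* d ℕ.* v)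
    exponent = ℕ-Solver.solve-∀

  block : ∀ q L → L ≤ K → K ℕ.* q ℕ.+ L < a →
    ∑ L (λ u → Ψ (suc (K ℕ.* q ℕ.+ u))) ≡ Z ^ q * (X₁ * G ⌈ L /2⌉ + X₂ * G ⌊ L /2⌋)
  block q L L≤K KqL<a = begin
    ∑ L F
      ≡⟨ ∑-parity L F ⟩
    ∑ ⌈ L /2⌉ (λ v → F (2 ℕ.* v)) + ∑ ⌊ L /2⌋ (λ v → F (suc (2 ℕ.* v)))
      ≡⟨ cong₂ _+_ (∑-congᵇ ⌈ L /2⌉ even) (∑-congᵇ ⌊ L /2⌋ odd) ⟩
    ∑ ⌈ L /2⌉ (λ v → Z ^ q * (X₁ * Y ^ v)) + ∑ ⌊ L /2⌋ (λ v → Z ^ q * (X₂ * Y ^ v))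
      ≡⟨ cong₂ _+_ (scale ⌈ L /2⌉ X₁) (scale ⌊ L /2⌋ X₂) ⟩
    Z ^ q * (X₁ * G ⌈ L /2⌉) + Z ^ q * (X₂ * G ⌊ L /2⌋)
      ≡⟨ ℤP.*-distribˡ-+ (Z ^ q) _ _ ⟨
    Z ^ q * (X₁ * G ⌈ L /2⌉ + X₂ * G ⌊ L /2⌋) ∎
    where
    open ≡-Reasoning
    F : ℕ → ℤ
    F u = Ψ (suc (K ℕ.* q ℕ.+ u))
    position< : ∀ {u} → u < L → suc (K ℕ.* q ℕ.+ u) < a
    position< u<L = ℕP.≤-<-trans (ℕP.+-monoʳ-< (K ℕ.* q) u<L) KqL<a
    even : ∀ v → v < ⌈ L /2⌉ → F (2 ℕ.* v) ≡ Z ^ q * (X₁ * Y ^ v)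
    even v v< = Ψ-even q v
      (ℕP.≤-pred (ℕP.<-≤-trans v< (subst (⌈ L /2⌉ ≤_) (⌈1+2n/2⌉≡1+n k) (ℕP.⌈n/2⌉-mono L≤K))))
      (position< (m<⌈n/2⌉⇒2m<n L v<))
    odd : ∀ v → v < ⌊ L /2⌋ → F (suc (2 ℕ.* v)) ≡ Z ^ q * (X₂ * Y ^ v)
    odd v v< = Ψ-odd q v
      (ℕP.<-≤-trans v< (subst (⌊ L /2⌋ ≤_) (⌊1+2n/2⌋≡n k) (ℕP.⌊n/2⌋-mono L≤K)))
      (position< (m<⌊n/2⌋⇒1+2m<n L v<))
    scale : ∀ n X → ∑ n (λ v → Z ^ q * (X * Y ^ v)) ≡ Z ^ q * (X * G n)
    scale n X = trans (∑-*ˡ n (Z ^ q) (λ v → X * Y ^ v)) (cong (Z ^ q *_) (∑-*ˡ n X (Y ^_)))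

  fullBlock<a : ∀ {q} → q < s → K ℕ.* q ℕ.+ K < a
  fullBlock<a {q} q<s = subst (K ℕ.* q ℕ.+ K <_) (sym a≡) (s≤s (begin
    K ℕ.* q ℕ.+ K      ≡⟨ ℕP.+-comm (K ℕ.* q) K ⟩
    K ℕ.+ K ℕ.* q      ≡⟨ ℕP.*-suc K q ⟨
    K ℕ.* suc q        ≤⟨ ℕP.*-monoʳ-≤ K q<s ⟩
    K ℕ.* s            ≤⟨ ℕP.m≤m+n (K ℕ.* s) t ⟩
    K ℕ.* s ℕ.+ t      ∎))
    where open ℕP.≤-Reasoning

  fullBlock : ∀ q → q < s → ∑ K (λ u → Ψ (suc (K ℕ.* q ℕ.+ u))) ≡ Z ^ q * Block
  fullBlock q q<s = begin
    ∑ K (λ u → Ψ (suc (K ℕ.* q ℕ.+ u)))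
      ≡⟨ block q K ℕP.≤-refl (fullBlock<a q<s) ⟩
    Z ^ q * (X₁ * G ⌈ K /2⌉ + X₂ * G ⌊ K /2⌋)
      ≡⟨ cong₂ (λ m n → Z ^ q * (X₁ * G m + X₂ * G n)) (⌈1+2n/2⌉≡1+n k) (⌊1+2n/2⌋≡n k) ⟩
    Z ^ q * Block ∎
    where open ≡-Reasoning

  f-expansion : sumFinℤ a (λ r → x ^ N r)
    ≡ + 1 + ∑ s (Z ^_) * Block + Z ^ s * Rest
  f-expansion = begin
    sumFinℤ a (λ r → x ^ N r)
      ≡⟨ sumFinℤ≡sum a (λ r → x ^ N r) ⟩
    ℤΣ.sum (λ r → x ^ N r)
      ≡⟨ ℤΣ.sum-permute (λ r → x ^ N r) ρ-permutation ⟩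
    ∑ a Ψ
      ≡⟨ cong (λ n → ∑ n Ψ) a≡ ⟩
    Ψ 0 + ∑ (K ℕ.* s ℕ.+ t) (Ψ ∘ suc)
      ≡⟨ cong₂ _+_ (cong (x ^_) (IsN-ρ0 (isN (ρ 0)))) (∑-+ (K ℕ.* s) t (Ψ ∘ suc)) ⟩
    + 1 + (∑ (K ℕ.* s) (Ψ ∘ suc) + ∑ t (λ u → Ψ (suc (K ℕ.* s ℕ.+ u))))
      ≡⟨ cong₂ (λ m n → + 1 + (m + n)) blocks (block s t t≤K (subst (K ℕ.* s ℕ.+ t <_) (sym a≡) ℕP.≤-refl)) ⟩
    + 1 + (∑ s (Z ^_) * Block + Z ^ s * Rest)
      ≡⟨ ℤP.+-assoc (+ 1) (∑ s (Z ^_) * Block) (Z ^ s * Rest) ⟨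
    + 1 + ∑ s (Z ^_) * Block + Z ^ s * Rest ∎
    where
    open ≡-Reasoning
    blocks : ∑ (K ℕ.* s) (Ψ ∘ suc) ≡ ∑ s (Z ^_) * Block
    blocks = trans (∑-blocks K s (Ψ ∘ suc))
               (trans (∑-congᵇ s fullBlock) (∑-*ʳ s Block (Z ^_)))

  clear-denominators : ∀ (Z Y X₁ X₂ Zˢ S G₁ G₂ G₃ G₄ : ℤ) {z y₁ y₂ y₃ y₄ w₁ w₂ : ℤ} →
    (+ 1 - Z) * S ≡ z → (+ 1 - Y) * G₁ ≡ y₁ → (+ 1 - Y) * G₂ ≡ y₂ →
    (+ 1 - Y) * G₃ ≡ y₃ → (+ 1 - Y) * G₄ ≡ y₄ → Zˢ * X₁ ≡ w₁ → Zˢ * X₂ ≡ w₂ →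
    (+ 1 + S * (X₁ * G₁ + X₂ * G₂) + Zˢ * (X₁ * G₃ + X₂ * G₄)) * (+ 1 - Z) * (+ 1 - Y)
      ≡ (+ 1 - Z) * (+ 1 - Y) + X₁ * z * y₁ + X₂ * z * y₂ + (+ 1 - Z) * (w₁ * y₃ + w₂ * y₄)
  clear-denominators Z Y X₁ X₂ Zˢ S G₁ G₂ G₃ G₄ refl refl refl refl refl refl refl =
    identity Z Y X₁ X₂ Zˢ S G₁ G₂ G₃ G₄
    where
    identity : ∀ (Z Y X₁ X₂ Zˢ S G₁ G₂ G₃ G₄ : ℤ) →
      (+ 1 + S * (X₁ * G₁ + X₂ * G₂) + Zˢ * (X₁ * G₃ + X₂ * G₄)) * (+ 1 - Z) * (+ 1 - Y)
        ≡ (+ 1 - Z) * (+ 1 - Y)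
          + X₁ * ((+ 1 - Z) * S) * ((+ 1 - Y) * G₁) + X₂ * ((+ 1 - Z) * S) * ((+ 1 - Y) * G₂)
          + (+ 1 - Z) * (Zˢ * X₁ * ((+ 1 - Y) * G₃) + Zˢ * X₂ * ((+ 1 - Y) * G₄))
    identity = ℤ-Solver.solve-∀

  closedForm : ∀ c c′ → 2 ℕ.* ⌈ t /2⌉ ≡ c → 2 ℕ.* ⌊ t /2⌋ ≡ c′ →
    sumFinℤ a (λ r → x ^ N r) * (+ 1 - Z) * (+ 1 - Y)
      ≡ (+ 1 - Z) * (+ 1 - Y)
        + X₁ * (+ 1 - x ^ (P ℕ.* s)) * (+ 1 - x ^ (2 ℕ.* d ℕ.* (k ℕ.+ 1)))
        + X₂ * (+ 1 - x ^ (P ℕ.* s)) * (+ 1 - x ^ (2 ℕ.* d ℕ.* k))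
        + (+ 1 - Z) * (x ^ (h ℕ.* a ℕ.* (s ℕ.+ 1) ℕ.+ d ℕ.* (K ℕ.* s ℕ.+ 1)) * (+ 1 - x ^ (d ℕ.* c))
                       + x ^ (h ℕ.* a ℕ.* (s ℕ.+ 2) ℕ.+ d ℕ.* (K ℕ.* s ℕ.+ 2)) * (+ 1 - x ^ (d ℕ.* c′)))
  closedForm c c′ 2⌈t/2⌉≡c 2⌊t/2⌋≡c′ =
    trans (cong (λ f → f * (+ 1 - Z) * (+ 1 - Y)) f-expansion)
      (clear-denominators Z Y X₁ X₂ (Z ^ s) (∑ s (Z ^_)) (G (suc k)) (G k) (G ⌈ t /2⌉) (G ⌊ t /2⌋)
        (∑-geometric-^ x P s)
        (geometric (2 ℕ.* d ℕ.* (k ℕ.+ 1)) (cong (2 ℕ.* d ℕ.*_) (ℕP.+-comm 1 k)))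
        (geometric (2 ℕ.* d ℕ.* k) refl)
        (geometric (d ℕ.* c) (halves ⌈ t /2⌉ c 2⌈t/2⌉≡c))
        (geometric (d ℕ.* c′) (halves ⌊ t /2⌋ c′ 2⌊t/2⌋≡c′))
        (shifted (h ℕ.* a ℕ.+ d) (exponent₁ h a k d s))
        (shifted (2 ℕ.* h ℕ.* a ℕ.+ 2 ℕ.* d) (exponent₂ h a k d s)))
    where
    geometric : ∀ {n} E → 2 ℕ.* d ℕ.* n ≡ E → (+ 1 - Y) * G n ≡ + 1 - x ^ E
    geometric {n} E eq = trans (∑-geometric-^ x (2 ℕ.* d) n) (cong (λ i → + 1 - x ^ i) eq)
    halves : ∀ n m → 2 ℕ.* n ≡ m → 2 ℕ.* d ℕ.* n ≡ d ℕ.* m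
    halves n m 2n≡m = trans (twice d n) (cong (d ℕ.*_) 2n≡m)
      where
      twice : ∀ d n → 2 ℕ.* d ℕ.* n ≡ d ℕ.* (2 ℕ.* n)
      twice = ℕ-Solver.solve-∀
    shifted : ∀ B {E} → E ≡ P ℕ.* s ℕ.+ B → Z ^ s * x ^ B ≡ x ^ E
    shifted B E≡ = trans (cong (_* x ^ B) (ℤP.^-*-assoc x P s))
                     (trans (sym (ℤP.^-distribˡ-+-* x (P ℕ.* s) B)) (cong (x ^_) (sym E≡)))
    exponent₁ : ∀ h a k d s → h ℕ.* a ℕ.* (s ℕ.+ 1) ℕ.+ d ℕ.* ((2 ℕ.* k ℕ.+ 1) ℕ.* s ℕ.+ 1)
      ≡ (h ℕ.* a ℕ.+ (2 ℕ.* k ℕ.+ 1) ℕ.* d) ℕ.* s ℕ.+ (h ℕ.* a ℕ.+ d)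
    exponent₁ = ℕ-Solver.solve-∀
    exponent₂ : ∀ h a k d s → h ℕ.* a ℕ.* (s ℕ.+ 2) ℕ.+ d ℕ.* ((2 ℕ.* k ℕ.+ 1) ℕ.* s ℕ.+ 2)
      ≡ (h ℕ.* a ℕ.+ (2 ℕ.* k ℕ.+ 1) ℕ.* d) ℕ.* s ℕ.+ (2 ℕ.* h ℕ.* a ℕ.+ 2 ℕ.* d)
    exponent₂ = ℕ-Solver.solve-∀

open Halving using (2*⌈n/2⌉≡n+n%2; 2*⌊n/2⌋≡n∸n%2)
open Modular using (coprime⇒invertible)

-- Only a > 1, gcd(a, d) = 1, h ≤ d and t ≤ 2k + 1 are used.
propositionA7 :
    (a h d k s t : ℕ) → .{{_ : NonZero a}} →
    1 ≤ h → 1 ≤ d → 1 ≤ k →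
    gcd a d ≡ 1 → 2 < a → h < d →
    1 ≤ 2 ℕ.* k ℕ.+ 1 → 2 ℕ.* k ℕ.+ 1 ≤ a ∸ 1 →
    a ∸ 1 ≡ (2 ℕ.* k ℕ.+ 1) ℕ.* s ℕ.+ t → 1 ≤ t → t ≤ 2 ℕ.* k ℕ.+ 1 →
    (N : Fin a → ℕ) → (∀ r → IsN a h d k (toℕ r) (N r)) →
    ∀ (x : ℤ) →
      let P  = h ℕ.* a ℕ.+ (2 ℕ.* k ℕ.+ 1) ℕ.* d
          D1 = + 1 - x ^ P
          D2 = + 1 - x ^ (2 ℕ.* d)
          f  = sumFinℤ a (λ r → x ^ N r)
          e1 = h ℕ.* a ℕ.* (s ℕ.+ 1) ℕ.+ d ℕ.* ((2 ℕ.* k ℕ.+ 1) ℕ.* s ℕ.+ 1)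
          e2 = h ℕ.* a ℕ.* (s ℕ.+ 2) ℕ.+ d ℕ.* ((2 ℕ.* k ℕ.+ 1) ℕ.* s ℕ.+ 2)
          rhsCommon = D1 ℤ.* D2
                      ℤ.+ x ^ (h ℕ.* a ℕ.+ d) ℤ.* (+ 1 - x ^ (P ℕ.* s))
                          ℤ.* (+ 1 - x ^ (2 ℕ.* d ℕ.* (k ℕ.+ 1)))
                      ℤ.+ x ^ (2 ℕ.* h ℕ.* a ℕ.+ 2 ℕ.* d) ℤ.* (+ 1 - x ^ (P ℕ.* s))
                          ℤ.* (+ 1 - x ^ (2 ℕ.* d ℕ.* k))
      in (t % 2 ≡ 1 →
            f ℤ.* D1 ℤ.* D2 ≡ rhsCommon
              ℤ.+ D1 ℤ.* (x ^ e1 ℤ.* (+ 1 - x ^ (d ℕ.* (t ℕ.+ 1)))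
                          ℤ.+ x ^ e2 ℤ.* (+ 1 - x ^ (d ℕ.* (t ∸ 1)))))
       × (t % 2 ≡ 0 →
            f ℤ.* D1 ℤ.* D2 ≡ rhsCommon
              ℤ.+ D1 ℤ.* (x ^ e1 ℤ.* (+ 1 - x ^ (d ℕ.* t))
                          ℤ.+ x ^ e2 ℤ.* (+ 1 - x ^ (d ℕ.* t))))
propositionA7 a h d k s t _ _ _ gcd≡1 2<a h<d _ _ a∸1≡ _ t≤K N isN x =
    (λ t%2≡1 → closedForm (t ℕ.+ 1) (t ∸ 1)
                 (trans (2*⌈n/2⌉≡n+n%2 t) (cong (t ℕ.+_) t%2≡1))
                 (trans (2*⌊n/2⌋≡n∸n%2 t) (cong (t ∸_) t%2≡1)))
  , (λ t%2≡0 → closedForm t t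
                 (trans (2*⌈n/2⌉≡n+n%2 t) (trans (cong (t ℕ.+_) t%2≡0) (ℕP.+-identityʳ t)))
                 (trans (2*⌊n/2⌋≡n∸n%2 t) (cong (t ∸_) t%2≡0)))
  where
  invertible : ∃[ e ] (e ℕ.* d) % a ≡ 1
  invertible = coprime⇒invertible (ℕP.<⇒≤ 2<a) d gcd≡1
  a≡ : a ≡ suc ((2 ℕ.* k ℕ.+ 1) ℕ.* s ℕ.+ t)
  a≡ = trans (sym (ℕP.m+[n∸m]≡n (ℕP.<⇒≤ (ℕP.<⇒≤ 2<a)))) (cong suc a∸1≡)
  open GeneratingFunction a h d k s t (ℕP.<⇒≤ h<d) (proj₁ invertible) (proj₂ invertible) a≡ t≤K N isN x
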